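{- Let $M$ be a partial commutative monoid and let $\mathrm{cl}$ be a strong closure operator on $\mathcal P(M)$ such that the lattice $\mathcal C=\{X\subseteq M\mid \mathrm{cl}(X)=X\}$ (ordered by inclusion) has a Heyting implication. Then $\mathcal C$, with $\bot=\mathrm{cl}(\emptyset)$, $\top=M$, $X\wedge Y=X\cap Y$, $X\vee Y=\mathrm{cl}(X\cup Y)$, the Heyting implication $\to$ of $\mathcal C$, $\mathsf{emp}=\mathrm{cl}(\{e\})$, $X*Y=\mathrm{cl}(X\bullet Y)$ and $X\mathrel{ -\!\!*}Y=\mathrm{cl}(X\mathrel{ -\!\!\bullet}Y)$, is a BI algebra.
   Context: A partial commutative monoid $(M,\cdot,e)$ has a partially defined commutative, associative composition with unit $e$. For $X,Y\subseteq M$: $X\bullet Y=\{x\cdot y\mid x\in X,y\in Y, x\cdot y\text{ defined}\}$ and $X\mathrel{ -\!\!\bullet}Y=\{z\mid \forall x\in X.\ z\cdot x\text{ defined}\Rightarrow z\cdot x\in Y\}$. A closure operator on $\mathcal P(M)$ is a map $\mathrm{cl}$ with $X\subseteq\mathrm{cl}(X)$, $X\subseteq Y\Rightarrow \mathrm{cl}(X)\subseteq\mathrm{cl}(Y)$, and $\mathrm{cl}(\mathrm{cl}(X))=\mathrm{cl}(X)$; it is strong if $\mathrm{cl}(X)\bullet Y\subseteq\mathrm{cl}(X\bullet Y)$ for all $X,Y\subseteq M$. A BI algebra is a tuple $(B,\bot,\top,\wedge,\vee,\to,\mathsf{emp},*,\mathrel{ -\!\!*})$ where $(B,\bot,\top,\wedge,\vee,\to)$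 is a bounded Heyting algebra, $*$ is a monotone commutative associative operation with unit $\mathsf{emp}$, and $a*b\le c\iff a\le b\mathrel{ -\!\!*}c$. -}

module Defs where

open import Level using (Level; suc; _⊔_)
open import Data.Maybe using (Maybe; just; nothing; _>>=_)
open import Data.Product using (Σ; ∃; _×_; _,_; proj₁; proj₂)
open import Data.Sum using (inj₁; inj₂)
open import Relation.Unary using (Pred; _⊆_; _∩_; _∪_; ｛_｝)
open import Data.Empty.Polymorphic using () renaming (⊥ to Empty)
open import Data.Unit.Polymorphic using () renaming (⊤ to Unit)
open import Relation.Binary using (Rel)
open import Relation.Binary.PropositionalEquality using (_≡_; refl)
open import Relation.Binary.Lattice.Structures using (IsHeytingAlgebra)
open import Relation.Binary.Lattice.Definitions using (Exponential)
open import Algebra.Core using (Op₂)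

-- Associativity is Kleene
-- equality: (x·y)·z is defined iff x·(y·z) is, and then they agree.

record PCM (ℓ : Level) : Set (suc ℓ) where
  field
    M     : Set ℓ
    _·_   : M → M → Maybe M
    e     : M
    comm  : ∀ x y → x · y ≡ y · x
    assoc : ∀ x y z → ((x · y) >>= λ w → w · z) ≡ ((y · z) >>= λ w → x · w)
    unitˡ : ∀ x → e · x ≡ just x

module _ {ℓ : Level} (P : PCM ℓ) where
  open PCM P

  Sub : Set (suc ℓ)
  Sub = Pred M ℓ

  _≐_ : Sub → Sub → Set ℓ
  X ≐ Y = X ⊆ Y × Y ⊆ X

  _•_ : Sub → Sub → Sub
  (X • Y) m = Σ M λ x → Σ M λ y → X x × Y y × (x · y ≡ just m)

  _-•_ : Sub → Sub → Sub
  (X -• Y) z = ∀ x w → X x → z · x ≡ just w → Y w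

  record IsStrongClosure (cl : Sub → Sub) : Set (suc ℓ) where
    field
      extensive  : ∀ X → X ⊆ cl X
      monotone   : ∀ {X Y} → X ⊆ Y → cl X ⊆ cl Y
      idempotent : ∀ X → cl (cl X) ≐ cl X
      strong     : ∀ X Y → (cl X • Y) ⊆ cl (X • Y)

record IsBIAlgebra {a ℓ₁ ℓ₂ : Level} {A : Set a}
                   (_≈_ : Rel A ℓ₁) (_≤_ : Rel A ℓ₂)
                   (⊥ ⊤ : A) (_∧_ _∨_ _⇒_ : Op₂ A)
                   (emp : A) (_✱_ _-✱_ : Op₂ A) : Set (a ⊔ ℓ₁ ⊔ ℓ₂) where
  field
    isHeytingAlgebra : IsHeytingAlgebra _≈_ _≤_ _∨_ _∧_ _⇒_ ⊤ ⊥
    ✱-mono    : ∀ {x x′ y y′} → x ≤ x′ → y ≤ y′ → (x ✱ y) ≤ (x′ ✱ y′)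
    ✱-comm    : ∀ x y → (x ✱ y) ≈ (y ✱ x)
    ✱-assoc   : ∀ x y z → ((x ✱ y) ✱ z) ≈ (x ✱ (y ✱ z))
    ✱-unit    : ∀ x → (emp ✱ x) ≈ x
    residuation : ∀ a b c → ((a ✱ b) ≤ c → a ≤ (b -✱ c)) × (a ≤ (b -✱ c) → (a ✱ b) ≤ c)

module ClosedSets {ℓ : Level} (P : PCM ℓ) (cl : Sub P → Sub P)
                  (isCl : IsStrongClosure P cl) where
  open PCM P
  open IsStrongClosure isCl

  ∅M : Sub P
  ∅M _ = Empty

  UM : Sub P
  UM _ = Unit

  Closed : Sub P → Set ℓ
  Closed X = _≐_ P (cl X) X

  𝒞 : Set (suc ℓ)
  𝒞 = Σ (Sub P) Closed

  _≤𝒞_ : 𝒞 → 𝒞 → Set ℓ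
  X ≤𝒞 Y = proj₁ X ⊆ proj₁ Y

  _≈𝒞_ : 𝒞 → 𝒞 → Set ℓ
  X ≈𝒞 Y = _≐_ P (proj₁ X) (proj₁ Y)

  clC : Sub P → 𝒞
  clC X = cl X , idempotent X

  ⊥𝒞 : 𝒞
  ⊥𝒞 = clC ∅M

  ⊤𝒞 : 𝒞
  ⊤𝒞 = UM , ((λ _ → _) , extensive UM)

  _∧𝒞_ : 𝒞 → 𝒞 → 𝒞
  (X , cX) ∧𝒞 (Y , cY) =
    (X ∩ Y) ,
    ((λ m → (proj₁ cX (monotone proj₁ m) , proj₁ cY (monotone proj₂ m))) ,
     extensive (X ∩ Y))

  _∨𝒞_ : 𝒞 → 𝒞 → 𝒞
  X ∨𝒞 Y = clC (proj₁ X ∪ proj₁ Y)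

  emp𝒞 : 𝒞
  emp𝒞 = clC ｛ e ｝

  _✱𝒞_ : 𝒞 → 𝒞 → 𝒞
  X ✱𝒞 Y = clC (_•_ P (proj₁ X) (proj₁ Y))

  _-✱𝒞_ : 𝒞 → 𝒞 → 𝒞
  X -✱𝒞 Y = clC (_-•_ P (proj₁ X) (proj₁ Y))

  IsHeytingImplication : (𝒞 → 𝒞 → 𝒞) → Set (suc ℓ)
  IsHeytingImplication _⇒_ = Exponential _≤𝒞_ _∧𝒞_ _⇒_

-- On 𝒫(M), • is a commutative monoid with unit {e} (associativity of •
-- is that of the partial composition) and -• is its right adjoint.
-- Strength lets cl be pulled out of either argument of •, so
-- cl(cl X • Y) = cl(X • Y); this makes X ✱ Y = cl(X • Y) associative with
-- unit cl{e} on closed sets.  The adjunction survives because a closed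
-- target absorbs the closure: cl(X • Y) ⊆ Z iff X • Y ⊆ Z, and dually
-- X ⊆ cl(Y -• Z) gives X • Y ⊆ cl((Y -• Z) • Y) ⊆ cl Z = Z.
module Submission where

open import Level using (Level)
open import Defs
open import Data.Maybe using (Maybe; just; _>>=_)
open import Data.Product using (Σ; _×_; _,_; proj₁; proj₂)
open import Data.Sum using (inj₁; inj₂; [_,_])
open import Function using (id)
open import Relation.Unary using (_⊆_; _∪_; ｛_｝)
open import Relation.Unary.Relation.Binary.Subset using (⊆-isPartialOrder)
open import Relation.Binary.PropositionalEquality using (_≡_; refl; sym; trans; cong)
open import Relation.Binary.Structures using (IsPartialOrder)
open import Relation.Binary.Definitions using (Maximum; Minimum)
open import Relation.Binary.Lattice.Definitions using (Supremum; Infimum)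
import Relation.Binary.Construct.On as On

>>=-just⁻ : ∀ {a} {A B : Set a} (mx : Maybe A) (f : A → Maybe B) {y : B} →
            (mx >>= f) ≡ just y → Σ A λ x → mx ≡ just x × f x ≡ just y
>>=-just⁻ (just x) f eq = x , refl , eq

module Convolution {ℓ : Level} (P : PCM ℓ) where
  open PCM P

  private
    _•′_ _-•′_ : Sub P → Sub P → Sub P
    _•′_ = _•_ P
    _-•′_ = _-•_ P

  •-mono : ∀ {X X′ Y Y′ : Sub P} → X ⊆ X′ → Y ⊆ Y′ → (X •′ Y) ⊆ (X′ •′ Y′)
  •-mono f g (x , y , x∈X , y∈Y , xy≡m) = x , y , f x∈X , g y∈Y , xy≡m

  •-comm : ∀ X Y → (X •′ Y) ⊆ (Y •′ X)
  •-comm X Y (x , y , x∈X , y∈Y , xy≡m) = y , x , y∈Y , x∈X , trans (comm y x) xy≡m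

  •-assocˡ : ∀ X Y Z → ((X •′ Y) •′ Z) ⊆ (X •′ (Y •′ Z))
  •-assocˡ X Y Z (w , z , (x , y , x∈X , y∈Y , xy≡w) , z∈Z , wz≡m)
    with >>=-just⁻ (y · z) (x ·_) xyz≡m
    where
      xyz≡m : ((y · z) >>= (x ·_)) ≡ just _
      xyz≡m = trans (sym (assoc x y z)) (trans (cong (_>>= (_· z)) xy≡w) wz≡m)
  ... | v , yz≡v , xv≡m = x , v , x∈X , (y , z , y∈Y , z∈Z , yz≡v) , xv≡m

  •-assocʳ : ∀ X Y Z → (X •′ (Y •′ Z)) ⊆ ((X •′ Y) •′ Z)
  •-assocʳ X Y Z x[yz] =
    •-mono (•-comm Y X) id (•-comm Z (Y •′ X)
      (•-assocˡ Z Y X (•-mono (•-comm Y Z) id (•-comm X (Y •′ Z) x[yz]))))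

  unit-•ˡ : ∀ X → (｛ e ｝ •′ X) ⊆ X
  unit-•ˡ X (_ , y , refl , y∈X , ey≡m) with trans (sym (unitˡ y)) ey≡m
  ... | refl = y∈X

  unit-•ˡ⁻ : ∀ X → X ⊆ (｛ e ｝ •′ X)
  unit-•ˡ⁻ X {y} y∈X = e , y , refl , y∈X , unitˡ y

  •⊆⇒⊆-• : ∀ {X Y Z} → (X •′ Y) ⊆ Z → X ⊆ (Y -•′ Z)
  •⊆⇒⊆-• XY⊆Z x∈X y _ y∈Y xy≡w = XY⊆Z (_ , y , x∈X , y∈Y , xy≡w)

  -•-eval : ∀ Y Z → ((Y -•′ Z) •′ Y) ⊆ Z
  -•-eval Y Z (x , y , x∈Y-•Z , y∈Y , xy≡m) = x∈Y-•Z y _ y∈Y xy≡m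

module StrongClosure {ℓ : Level} (P : PCM ℓ) (cl : Sub P → Sub P)
                     (isCl : IsStrongClosure P cl) where
  open IsStrongClosure isCl
  open Convolution P

  private
    _•′_ : Sub P → Sub P → Sub P
    _•′_ = _•_ P

  strongʳ : ∀ X Y → (X •′ cl Y) ⊆ cl (X •′ Y)
  strongʳ X Y xy∈ = monotone (•-comm Y X) (strong Y X (•-comm X (cl Y) xy∈))

  cl-⊆-cl : ∀ {X Y} → X ⊆ cl Y → cl X ⊆ cl Y
  cl-⊆-cl {Y = Y} X⊆clY x∈clX = proj₁ (idempotent Y) (monotone X⊆clY x∈clX)

  cl-•-clˡ : ∀ X Y Z → (cl (X •′ Y) •′ Z) ⊆ cl (X •′ (Y •′ Z))
  cl-•-clˡ X Y Z xyz∈ = monotone (•-assocˡ X Y Z) (strong (X •′ Y) Z xyz∈)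

  cl-•-clʳ : ∀ X Y Z → (X •′ cl (Y •′ Z)) ⊆ cl ((X •′ Y) •′ Z)
  cl-•-clʳ X Y Z xyz∈ = monotone (•-assocʳ X Y Z) (strongʳ X (Y •′ Z) xyz∈)

module ClosedSetAlgebra {ℓ : Level} (P : PCM ℓ) (cl : Sub P → Sub P)
                        (isCl : IsStrongClosure P cl) where
  open PCM P using (e)
  open IsStrongClosure isCl
  open Convolution P
  open StrongClosure P cl isCl
  open ClosedSets P cl isCl

  private
    _•′_ _-•′_ : Sub P → Sub P → Sub P
    _•′_ = _•_ P
    _-•′_ = _-•_ P

  closed-absorbs-cl : ∀ {X} (Z : 𝒞) → X ⊆ proj₁ Z → cl X ⊆ proj₁ Z
  closed-absorbs-cl (Z , clZ⊆Z , _) X⊆Z x∈clX = clZ⊆Z (monotone X⊆Z x∈clX)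

  ≤𝒞-isPartialOrder : IsPartialOrder _≈𝒞_ _≤𝒞_
  ≤𝒞-isPartialOrder = On.isPartialOrder proj₁ ⊆-isPartialOrder

  ∨𝒞-supremum : Supremum _≤𝒞_ _∨𝒞_
  ∨𝒞-supremum X Y =
      (λ x∈X → extensive (proj₁ X ∪ proj₁ Y) (inj₁ x∈X))
    , (λ y∈Y → extensive (proj₁ X ∪ proj₁ Y) (inj₂ y∈Y))
    , λ Z X⊆Z Y⊆Z → closed-absorbs-cl Z [ X⊆Z , Y⊆Z ]

  ∧𝒞-infimum : Infimum _≤𝒞_ _∧𝒞_
  ∧𝒞-infimum X Y = proj₁ , proj₂ , λ Z Z⊆X Z⊆Y z∈Z → Z⊆X z∈Z , Z⊆Y z∈Z

  ⊥𝒞-minimum : Minimum _≤𝒞_ ⊥𝒞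
  ⊥𝒞-minimum X = closed-absorbs-cl X λ ()

  ⊤𝒞-maximum : Maximum _≤𝒞_ ⊤𝒞
  ⊤𝒞-maximum X _ = _

  ✱𝒞-mono : ∀ {X X′ Y Y′} → X ≤𝒞 X′ → Y ≤𝒞 Y′ → (X ✱𝒞 Y) ≤𝒞 (X′ ✱𝒞 Y′)
  ✱𝒞-mono X⊆X′ Y⊆Y′ = monotone (•-mono X⊆X′ Y⊆Y′)

  ✱𝒞-comm : ∀ X Y → (X ✱𝒞 Y) ≈𝒞 (Y ✱𝒞 X)
  ✱𝒞-comm (X , _) (Y , _) = monotone (•-comm X Y) , monotone (•-comm Y X)

  ✱𝒞-assoc : ∀ X Y Z → ((X ✱𝒞 Y) ✱𝒞 Z) ≈𝒞 (X ✱𝒞 (Y ✱𝒞 Z))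
  ✱𝒞-assoc (X , _) (Y , _) (Z , _) =
      cl-⊆-cl (λ xyz∈ → monotone (•-mono {X} id (extensive (Y •′ Z))) (cl-•-clˡ X Y Z xyz∈))
    , cl-⊆-cl (λ xyz∈ → monotone (•-mono {Y = Z} (extensive (X •′ Y)) id) (cl-•-clʳ X Y Z xyz∈))

  ✱𝒞-unit : ∀ X → (emp𝒞 ✱𝒞 X) ≈𝒞 X
  ✱𝒞-unit X@(X′ , _) =
      closed-absorbs-cl X (λ eX∈emp•X →
        closed-absorbs-cl X (unit-•ˡ X′) (strong ｛ e ｝ X′ eX∈emp•X))
    , λ x∈X → extensive (cl ｛ e ｝ •′ X′) (•-mono (extensive ｛ e ｝) id (unit-•ˡ⁻ X′ x∈X))

  ✱𝒞-residuation : ∀ X Y Z →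
    ((X ✱𝒞 Y) ≤𝒞 Z → X ≤𝒞 (Y -✱𝒞 Z)) × (X ≤𝒞 (Y -✱𝒞 Z) → (X ✱𝒞 Y) ≤𝒞 Z)
  ✱𝒞-residuation (X , _) (Y , _) Z@(Z′ , _) =
      (λ clXY⊆Z x∈X → extensive (Y -•′ Z′)
         (•⊆⇒⊆-• (λ xy∈XY → clXY⊆Z (extensive (X •′ Y) xy∈XY)) x∈X))
    , λ X⊆clY-•Z → closed-absorbs-cl Z λ xy∈XY →
        closed-absorbs-cl Z (-•-eval Y Z′) (strong (Y -•′ Z′) Y (•-mono X⊆clY-•Z id xy∈XY))

theorem5p8 : {ℓ : Level} (P : PCM ℓ) (cl : Sub P → Sub P)
    (isCl : IsStrongClosure P cl) →
    let open ClosedSets P cl isCl in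
    (_⇒_ : 𝒞 → 𝒞 → 𝒞) → IsHeytingImplication _⇒_ →
    IsBIAlgebra _≈𝒞_ _≤𝒞_ ⊥𝒞 ⊤𝒞 _∧𝒞_ _∨𝒞_ _⇒_ emp𝒞 _✱𝒞_ _-✱𝒞_
theorem5p8 P cl isCl _⇒_ ⇒-exponential = record
  { isHeytingAlgebra = record
    { isBoundedLattice = record
      { isLattice = record
        { isPartialOrder = ≤𝒞-isPartialOrder
        ; supremum = ∨𝒞-supremum
        ; infimum = ∧𝒞-infimum
        }
      ; maximum = ⊤𝒞-maximum
      ; minimum = ⊥𝒞-minimum
      }
    ; exponential = ⇒-exponential
    }
  ; ✱-mono = λ {X} {X′} {Y} {Y′} → ✱𝒞-mono {X} {X′} {Y} {Y′}
  ; ✱-comm = ✱𝒞-comm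
  ; ✱-assoc = ✱𝒞-assoc
  ; ✱-unit = ✱𝒞-unit
  ; residuation = ✱𝒞-residuation
  }
  where open ClosedSetAlgebra P cl isCl
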